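{- Let $(U,R_1,\ldots,R_T,\pi^0)$ be an instance of $\mathrm{Mult}\text{ - }\mathrm{MSSC}$, let $\mathrm{OPT}_{\mathrm{Mult}\text{ - }\mathrm{MSSC}}$ denote its optimal cost, and let $A^0=\pi^0,A^1,\ldots,A^T$ be an optimal solution of the linear program Fractional-MTF for this instance. Then $\sum_{t=1}^T\mathrm{d}_{\mathrm{FR}}(A^t,A^{t-1})\le 4\cdot\mathrm{OPT}_{\mathrm{Mult}\text{ - }\mathrm{MSSC}}$.
   Context: $U$ is a finite set of $n$ elements. A permutation $\pi$ of $U$ is a list $\pi_1,\ldots,\pi_n$ ($\pi_i$ the element at position $i$); it is identified with the $0$-$1$ matrix $A$ (rows indexed by elements, columns by positions) with $A_{ei}=1$ iff $e$ is at position $i$. $\mathrm{Mult}\text{ - }\mathrm{MSSC}$: given requests $R_1,\ldots,R_T\subseteq U$ and an initial permutation $\pi^0$, choose permutations $\pi^1,\ldots,\pi^T$ minimizing $\sum_{t=1}^T\pi^t(R_t)+\sum_{t=1}^T\mathrm{d}_{\mathrm{KT}}(\pi^t,\pi^{t-1})$, where $\pi(R)=\min\{i:\pi_i\in R\}$ and $\mathrm{d}_{\mathrm{KT}}$ (Kendall-Tau distance) counts pairs of elements ordered differently by the two permutations. A nonnegative $n\times n$ matrix is stochastic if each row sums to $1$ and doubly stochastic if moreover each column sums to $1$. For stochastic matrices $A,B$, the footrule distance $\mathrm{d}_{\mathrm{FR}}(A,B)$ is the optimal value of the transportation LP: minimize $\sum_{e\in U}\sum_{i,j=1}^n|i-j|f^e_{ij}$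 subject to $\sum_i f^e_{ij}=B_{ej}$ for all $e,j$, $\sum_j f^e_{ij}=A_{ei}$ for all $e,i$, $f^e_{ij}\ge0$. Fractional-MTF is the linear program: minimize $\sum_{t=1}^T\mathrm{d}_{\mathrm{FR}}(A^t,A^{t-1})$ over $n\times n$ matrices $A^1,\ldots,A^T$ such that each $A^t$ is doubly stochastic, $\sum_{e\in R_t}A^t_{e1}=1$ for all $t$, and $A^0=\pi^0$. -}

module Defs where

open import Data.Nat as ℕ using (ℕ; zero; suc; ∣_-_∣)
open import Data.Bool using (Bool; true; false; if_then_else_; _xor_)
open import Data.Fin using (Fin; zero; suc; toℕ; inject₁; _<_; _≟_)
open import Data.Fin.Subset using (Subset)
open import Data.Fin.Permutation using (Permutation′; _⟨$⟩ʳ_; _⟨$⟩ˡ_)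
open import Data.Vec using (lookup)
open import Data.Integer using (+_)
open import Data.Rational using (ℚ; 0ℚ; 1ℚ; _+_; _*_; _≤_; _/_)
open import Relation.Nullary.Decidable using (⌊_⌋)
open import Data.Product using (Σ; _×_)
open import Relation.Binary.PropositionalEquality using (_≡_)

Σℚ : {n : ℕ} → (Fin n → ℚ) → ℚ
Σℚ {zero}  f = 0ℚ
Σℚ {suc n} f = f zero + Σℚ (λ i → f (suc i))

Σℕ : {n : ℕ} → (Fin n → ℕ) → ℕ
Σℕ {zero}  f = 0
Σℕ {suc n} f = f zero ℕ.+ Σℕ (λ i → f (suc i))

ℕtoℚ : ℕ → ℚ
ℕtoℚ k = (+ k) / 1

-- Given x⁰ and x¹,…,x^T (indexed by Fin T, index t standing for time t+1),
-- prevOf x⁰ xs t is x^{t-1} relative to time t+1, i.e. the previous entry.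
prevOf : {X : Set} {T : ℕ} → X → (Fin T → X) → Fin T → X
prevOf {T = suc T} x0 xs zero    = x0
prevOf {T = suc T} x0 xs (suc t) = xs (inject₁ t)

-- U = Fin n; positions 1..n are represented by Fin n (0..n-1).
-- A permutation π : Permutation′ n maps a position i to the element π ⟨$⟩ʳ i
-- placed there; π ⟨$⟩ˡ e is the position of element e.

-- π(R) = min { i : π_i ∈ R }, positions counted from 1.
-- (For R = ∅ this returns n+1; empty requests make Fractional-MTF infeasible,
-- so this convention never matters for the statement.)
firstHit : {n : ℕ} → (Fin n → Bool) → ℕ
firstHit {zero}  p = 1
firstHit {suc n} p = if p zero then 1 else suc (firstHit (λ i → p (suc i)))

coverTime : {n : ℕ} → Permutation′ n → Subset n → ℕ
coverTime π R = firstHit (λ i → lookup R (π ⟨$⟩ʳ i))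

dKT : {n : ℕ} → Permutation′ n → Permutation′ n → ℕ
dKT π σ = Σℕ (λ e → Σℕ (λ f →
  if ⌊ e Data.Fin.<? f ⌋
  then (if ⌊ (π ⟨$⟩ˡ e) Data.Fin.<? (π ⟨$⟩ˡ f) ⌋ xor ⌊ (σ ⟨$⟩ˡ e) Data.Fin.<? (σ ⟨$⟩ˡ f) ⌋
        then 1 else 0)
  else 0))

msscCost : {n T : ℕ} → (R : Fin T → Subset n) → (π0 : Permutation′ n) →
           (πs : Fin T → Permutation′ n) → ℕ
msscCost R π0 πs =
  Σℕ (λ t → coverTime (πs t) (R t)) ℕ.+ Σℕ (λ t → dKT (πs t) (prevOf π0 πs t))

-- Matrices: rows = elements, columns = positions.

Matrix : ℕ → Set
Matrix n = Fin n → Fin n → ℚ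

permMatrix : {n : ℕ} → Permutation′ n → Matrix n
permMatrix π e i = if ⌊ π ⟨$⟩ʳ i ≟ e ⌋ then 1ℚ else 0ℚ

Nonneg : {n : ℕ} → Matrix n → Set
Nonneg A = ∀ e i → 0ℚ ≤ A e i

Stochastic : {n : ℕ} → Matrix n → Set
Stochastic A = Nonneg A × (∀ e → Σℚ (λ i → A e i) ≡ 1ℚ)

DoublyStochastic : {n : ℕ} → Matrix n → Set
DoublyStochastic A = Stochastic A × (∀ i → Σℚ (λ e → A e i) ≡ 1ℚ)

-- A flow f e i j ("mass of row e moved from column i (of A) to column j (of B)").
Flow : ℕ → Set
Flow n = Fin n → Fin n → Fin n → ℚ

FeasibleFlow : {n : ℕ} → Matrix n → Matrix n → Flow n → Set
FeasibleFlow A B f =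
  (∀ e i j → 0ℚ ≤ f e i j) ×
  (∀ e j → Σℚ (λ i → f e i j) ≡ B e j) ×
  (∀ e i → Σℚ (λ j → f e i j) ≡ A e i)

flowCost : {n : ℕ} → Flow n → ℚ
flowCost f = Σℚ (λ e → Σℚ (λ i → Σℚ (λ j → ℕtoℚ ∣ toℕ i - toℕ j ∣ * f e i j)))

IsFootrule : {n : ℕ} → Matrix n → Matrix n → ℚ → Set
IsFootrule {n} A B v =
  Σ (Flow n) (λ f → FeasibleFlow A B f × flowCost f ≡ v) ×
  (∀ g → FeasibleFlow A B g → v ≤ flowCost g)

-- Entry of column "position 1" (0ℚ if there are no positions, n = 0).
col1 : {n : ℕ} → (Fin n → ℚ) → ℚ
col1 {zero}  v = 0ℚ
col1 {suc n} v = v zero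

FeasibleMTF : {n T : ℕ} → (R : Fin T → Subset n) → (As : Fin T → Matrix n) → Set
FeasibleMTF R As =
  (∀ t → DoublyStochastic (As t)) ×
  (∀ t → Σℚ (λ e → if lookup (R t) e then col1 (As t e) else 0ℚ) ≡ 1ℚ)

FootruleValues : {n T : ℕ} → (π0 : Permutation′ n) → (As : Fin T → Matrix n) →
                 (Fin T → ℚ) → Set
FootruleValues π0 As ds =
  ∀ t → IsFootrule (As t) (prevOf (permMatrix π0) As t) (ds t)

OptimalMTF : {n T : ℕ} → (R : Fin T → Subset n) → (π0 : Permutation′ n) →
             (As : Fin T → Matrix n) → Set
OptimalMTF {n} {T} R π0 As =
  FeasibleMTF R As ×
  (∀ (Bs : Fin T → Matrix n) → FeasibleMTF R Bs →
   ∀ (dA dB : Fin T → ℚ) → FootruleValues π0 As dA → FootruleValues π0 Bs dB →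
   Σℚ dA ≤ Σℚ dB)

-- Take any solution π¹,…,πᵀ of Mult-MSSC and let σᵗ be πᵗ with its first element
-- of Rₜ swapped to the front. The permutation matrices of the σᵗ are feasible for
-- Fractional-MTF, and between permutation matrices d_FR is Spearman's footrule F,
-- so by optimality the LP value is at most Σₜ F(σᵗ, σᵗ⁻¹). The swap costs
-- F(σᵗ, πᵗ) ≤ 2 πᵗ(Rₜ), and F ≤ 2 d_KT (Diaconis–Graham); the triangle inequality
-- through πᵗ and πᵗ⁻¹ then bounds Σₜ F(σᵗ, σᵗ⁻¹) by 4 Σ πᵗ(Rₜ) + 2 Σ d_KT.
module Submission where

open import Defs
open import Data.Nat as ℕ using (ℕ; zero; suc)
open import Data.Fin using (Fin)
open import Data.Fin.Subset using (Subset)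
open import Data.Fin.Permutation using (Permutation′)

module DecidableTruth where

  open import Data.Bool using (true; false)
  open import Relation.Nullary using (Dec; ¬_)
  open import Relation.Nullary.Decidable using (⌊_⌋; dec-true; dec-false; does-⇔; isYes≗does)
  open import Relation.Binary.PropositionalEquality
  open import Function using (_⇔_)

  ⌊⌋-true : ∀ {a} {A : Set a} (a? : Dec A) → A → ⌊ a? ⌋ ≡ true
  ⌊⌋-true a? a = trans (isYes≗does a?) (dec-true a? a)

  ⌊⌋-false : ∀ {a} {A : Set a} (a? : Dec A) → ¬ A → ⌊ a? ⌋ ≡ false
  ⌊⌋-false a? ¬a = trans (isYes≗does a?) (dec-false a? ¬a)

  ⌊⌋-⇔ : ∀ {a b} {A : Set a} {B : Set b} → A ⇔ B → (a? : Dec A) (b? : Dec B) → ⌊ a? ⌋ ≡ ⌊ b? ⌋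
  ⌊⌋-⇔ A⇔B a? b? = trans (isYes≗does a?) (trans (does-⇔ A⇔B a? b?) (sym (isYes≗does b?)))

module PermutationInverse where

  open import Data.Fin.Permutation using (_⟨$⟩ʳ_; _⟨$⟩ˡ_; inverseˡ; inverseʳ)
  open import Relation.Binary.PropositionalEquality

  module _ {n : ℕ} (π : Permutation′ n) where

    ⟨$⟩ʳ≡⇒≡⟨$⟩ˡ : ∀ {i e} → π ⟨$⟩ʳ i ≡ e → i ≡ π ⟨$⟩ˡ e
    ⟨$⟩ʳ≡⇒≡⟨$⟩ˡ refl = sym (inverseˡ π)

    ≡⟨$⟩ˡ⇒⟨$⟩ʳ≡ : ∀ {i e} → i ≡ π ⟨$⟩ˡ e → π ⟨$⟩ʳ i ≡ e
    ≡⟨$⟩ˡ⇒⟨$⟩ʳ≡ refl = inverseʳ π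

    ⟨$⟩ˡ-injective : ∀ {e f} → π ⟨$⟩ˡ e ≡ π ⟨$⟩ˡ f → e ≡ f
    ⟨$⟩ˡ-injective πˡe≡πˡf = trans (sym (inverseʳ π)) (≡⟨$⟩ˡ⇒⟨$⟩ʳ≡ πˡe≡πˡf)

module NatSum where

  open import Data.Nat using (_+_; _≤_; z≤n; ∣_-_∣)
  open import Data.Nat.Properties
  open import Data.Fin using (zero; suc; inject₁; fromℕ)
  import Data.Fin.Properties as Fin
  open import Data.Fin.Permutation using (_⟨$⟩ʳ_)
  open import Relation.Binary.PropositionalEquality
  open import Relation.Nullary using (¬_)
  open import Function using (_∘′_)
  import Algebra.Properties.CommutativeMonoid.Sum as CommutativeMonoidSum

  private
    module Sum = CommutativeMonoidSum +-0-commutativeMonoid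

  Σℕ≡sum : ∀ {n} (f : Fin n → ℕ) → Σℕ f ≡ Sum.sum f
  Σℕ≡sum {zero}  f = refl
  Σℕ≡sum {suc n} f = cong (f zero +_) (Σℕ≡sum (λ i → f (suc i)))

  Σℕ-cong : ∀ {n} {f g : Fin n → ℕ} → (∀ i → f i ≡ g i) → Σℕ f ≡ Σℕ g
  Σℕ-cong {zero}  f≗g = refl
  Σℕ-cong {suc n} f≗g = cong₂ _+_ (f≗g zero) (Σℕ-cong (λ i → f≗g (suc i)))

  Σℕ-mono-≤ : ∀ {n} {f g : Fin n → ℕ} → (∀ i → f i ≤ g i) → Σℕ f ≤ Σℕ g
  Σℕ-mono-≤ {zero}  f≤g = z≤n
  Σℕ-mono-≤ {suc n} f≤g = +-mono-≤ (f≤g zero) (Σℕ-mono-≤ (λ i → f≤g (suc i)))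

  Σℕ-zero : ∀ {n} {f : Fin n → ℕ} → (∀ i → f i ≡ 0) → Σℕ f ≡ 0
  Σℕ-zero {zero}  f≗0 = refl
  Σℕ-zero {suc n} f≗0 = cong₂ _+_ (f≗0 zero) (Σℕ-zero (λ i → f≗0 (suc i)))

  Σℕ-single : ∀ {n} {f : Fin n → ℕ} (k : Fin n) → (∀ i → ¬ i ≡ k → f i ≡ 0) → Σℕ f ≡ f k
  Σℕ-single {suc n} {f} zero    off = trans (cong (f zero +_) (Σℕ-zero (λ i → off (suc i) λ ())))
                                            (+-identityʳ (f zero))
  Σℕ-single {suc n} {f} (suc k) off =
    cong₂ _+_ (off zero λ ()) (Σℕ-single k (λ i i≢k → off (suc i) (i≢k ∘′ Fin.suc-injective)))

  Σℕ-+ : ∀ {n} (f g : Fin n → ℕ) → Σℕ (λ i → f i + g i) ≡ Σℕ f + Σℕ g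
  Σℕ-+ f g = begin
    Σℕ (λ i → f i + g i)      ≡⟨ Σℕ≡sum (λ i → f i + g i) ⟩
    Sum.sum (λ i → f i + g i) ≡⟨ Sum.∑-distrib-+ f g ⟩
    Sum.sum f + Sum.sum g     ≡⟨ sym (cong₂ _+_ (Σℕ≡sum f) (Σℕ≡sum g)) ⟩
    Σℕ f + Σℕ g               ∎
    where open ≡-Reasoning

  Σℕ-comm : ∀ {m n} (f : Fin m → Fin n → ℕ) →
            Σℕ (λ i → Σℕ (λ j → f i j)) ≡ Σℕ (λ j → Σℕ (λ i → f i j))
  Σℕ-comm f = begin
    Σℕ (λ i → Σℕ (λ j → f i j))           ≡⟨ Σℕ-cong (λ i → Σℕ≡sum (f i)) ⟩
    Σℕ (λ i → Sum.sum (f i))              ≡⟨ Σℕ≡sum (λ i → Sum.sum (f i)) ⟩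
    Sum.sum (λ i → Sum.sum (f i))         ≡⟨ Sum.∑-comm f ⟩
    Sum.sum (λ j → Sum.sum (λ i → f i j)) ≡⟨ sym (Σℕ≡sum (λ j → Sum.sum (λ i → f i j))) ⟩
    Σℕ (λ j → Sum.sum (λ i → f i j))      ≡⟨ sym (Σℕ-cong (λ j → Σℕ≡sum (λ i → f i j))) ⟩
    Σℕ (λ j → Σℕ (λ i → f i j))           ∎
    where open ≡-Reasoning

  Σℕ-permute : ∀ {n} (f : Fin n → ℕ) (π : Permutation′ n) → Σℕ f ≡ Σℕ (λ i → f (π ⟨$⟩ʳ i))
  Σℕ-permute f π = begin
    Σℕ f                          ≡⟨ Σℕ≡sum f ⟩
    Sum.sum f                     ≡⟨ Sum.sum-permute f π ⟩
    Sum.sum (λ i → f (π ⟨$⟩ʳ i)) ≡⟨ sym (Σℕ≡sum (λ i → f (π ⟨$⟩ʳ i))) ⟩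
    Σℕ (λ i → f (π ⟨$⟩ʳ i))      ∎
    where open ≡-Reasoning

  Σℕ-init≤ : ∀ {n} (f : Fin (suc n) → ℕ) → Σℕ (λ i → f (inject₁ i)) ≤ Σℕ f
  Σℕ-init≤ {n} f = begin
    Σℕ (λ i → f (inject₁ i))                     ≤⟨ m≤m+n _ _ ⟩
    Σℕ (λ i → f (inject₁ i)) + f (fromℕ n)        ≡⟨ cong (_+ f (fromℕ n)) (Σℕ≡sum (λ i → f (inject₁ i))) ⟩
    Sum.sum (λ i → f (inject₁ i)) + f (fromℕ n)   ≡⟨ sym (Sum.sum-init-last f) ⟩
    Sum.sum f                                    ≡⟨ sym (Σℕ≡sum f) ⟩
    Σℕ f                                         ∎
    where open ≤-Reasoning

  ∣m+n-o+p∣≤∣m-o∣+∣n-p∣ : ∀ m n o p → ∣ m + n - o + p ∣ ≤ ∣ m - o ∣ + ∣ n - p ∣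
  ∣m+n-o+p∣≤∣m-o∣+∣n-p∣ m n o p = begin
    ∣ m + n - o + p ∣                     ≤⟨ ∣-∣-triangle (m + n) (o + n) (o + p) ⟩
    ∣ m + n - o + n ∣ + ∣ o + n - o + p ∣ ≡⟨ cong (_+ ∣ o + n - o + p ∣) (cong₂ ∣_-_∣ (+-comm m n) (+-comm o n)) ⟩
    ∣ n + m - n + o ∣ + ∣ o + n - o + p ∣ ≡⟨ cong₂ _+_ (∣m+n-m+o∣≡∣n-o∣ n m o) (∣m+n-m+o∣≡∣n-o∣ o n p) ⟩
    ∣ m - o ∣ + ∣ n - p ∣                 ∎
    where open ≤-Reasoning

  ∣Σℕ-Σℕ∣≤Σℕ∣-∣ : ∀ {n} (f g : Fin n → ℕ) → ∣ Σℕ f - Σℕ g ∣ ≤ Σℕ (λ i → ∣ f i - g i ∣)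
  ∣Σℕ-Σℕ∣≤Σℕ∣-∣ {zero}  f g = z≤n
  ∣Σℕ-Σℕ∣≤Σℕ∣-∣ {suc n} f g =
    ≤-trans (∣m+n-o+p∣≤∣m-o∣+∣n-p∣ (f zero) _ (g zero) _)
            (+-monoʳ-≤ ∣ f zero - g zero ∣ (∣Σℕ-Σℕ∣≤Σℕ∣-∣ (λ i → f (suc i)) (λ i → g (suc i))))

module RationalSum where

  import Data.Integer as ℤ
  import Data.Integer.Properties as ℤ
  import Data.Nat.Coprimality as Coprimality
  open import Data.Rational using (ℚ; 0ℚ; _+_; _*_; _≤_; toℚᵘ)
  open import Data.Rational.Properties
  open import Data.Rational.Unnormalised as ℚᵘ using (mkℚᵘ; *≡*; *≤*)
  import Data.Rational.Unnormalised.Properties as ℚᵘ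
  open import Data.Fin using (zero; suc)
  import Data.Fin.Properties as Fin
  open import Relation.Binary.PropositionalEquality
  open import Relation.Nullary using (¬_)
  open import Function using (_∘′_)

  toℚᵘ-ℕtoℚ : ∀ k → toℚᵘ (ℕtoℚ k) ≡ mkℚᵘ (ℤ.+ k) 0
  toℚᵘ-ℕtoℚ k = cong toℚᵘ (normalize-coprime (Coprimality.sym (Coprimality.1-coprimeTo k)))

  ℕtoℚ-+ : ∀ a b → ℕtoℚ (a ℕ.+ b) ≡ ℕtoℚ a + ℕtoℚ b
  ℕtoℚ-+ a b = toℚᵘ-injective (begin
    toℚᵘ (ℕtoℚ (a ℕ.+ b))                 ≡⟨ toℚᵘ-ℕtoℚ (a ℕ.+ b) ⟩
    mkℚᵘ (ℤ.+ (a ℕ.+ b)) 0                ≈⟨ *≡* (cong (ℤ._* ℤ.1ℤ) +[a+b]≡+a*1++b*1) ⟩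
    mkℚᵘ (ℤ.+ a) 0 ℚᵘ.+ mkℚᵘ (ℤ.+ b) 0    ≡⟨ cong₂ ℚᵘ._+_ (toℚᵘ-ℕtoℚ a) (toℚᵘ-ℕtoℚ b) ⟨
    toℚᵘ (ℕtoℚ a) ℚᵘ.+ toℚᵘ (ℕtoℚ b)      ≈⟨ toℚᵘ-homo-+ (ℕtoℚ a) (ℕtoℚ b) ⟨
    toℚᵘ (ℕtoℚ a + ℕtoℚ b)                ∎)
    where
    open ℚᵘ.≃-Reasoning
    +[a+b]≡+a*1++b*1 : ℤ.+ (a ℕ.+ b) ≡ ℤ.+ a ℤ.* ℤ.1ℤ ℤ.+ ℤ.+ b ℤ.* ℤ.1ℤ
    +[a+b]≡+a*1++b*1 = trans (ℤ.pos-+ a b) (sym (cong₂ ℤ._+_ (ℤ.*-identityʳ (ℤ.+ a)) (ℤ.*-identityʳ (ℤ.+ b))))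

  ℕtoℚ-* : ∀ a b → ℕtoℚ (a ℕ.* b) ≡ ℕtoℚ a * ℕtoℚ b
  ℕtoℚ-* a b = toℚᵘ-injective (begin
    toℚᵘ (ℕtoℚ (a ℕ.* b))                 ≡⟨ toℚᵘ-ℕtoℚ (a ℕ.* b) ⟩
    mkℚᵘ (ℤ.+ (a ℕ.* b)) 0                ≈⟨ *≡* (cong (ℤ._* ℤ.1ℤ) (ℤ.pos-* a b)) ⟩
    mkℚᵘ (ℤ.+ a) 0 ℚᵘ.* mkℚᵘ (ℤ.+ b) 0    ≡⟨ cong₂ ℚᵘ._*_ (toℚᵘ-ℕtoℚ a) (toℚᵘ-ℕtoℚ b) ⟨
    toℚᵘ (ℕtoℚ a) ℚᵘ.* toℚᵘ (ℕtoℚ b)      ≈⟨ toℚᵘ-homo-* (ℕtoℚ a) (ℕtoℚ b) ⟨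
    toℚᵘ (ℕtoℚ a * ℕtoℚ b)                ∎)
    where open ℚᵘ.≃-Reasoning

  ℕtoℚ-mono-≤ : ∀ {a b} → a ℕ.≤ b → ℕtoℚ a ≤ ℕtoℚ b
  ℕtoℚ-mono-≤ {a} {b} a≤b = toℚᵘ-cancel-≤ (subst₂ ℚᵘ._≤_ (sym (toℚᵘ-ℕtoℚ a)) (sym (toℚᵘ-ℕtoℚ b))
    (*≤* (ℤ.*-monoʳ-≤-nonNeg ℤ.1ℤ (ℤ.+≤+ a≤b))))

  Σℚ-cong : ∀ {n} {f g : Fin n → ℚ} → (∀ i → f i ≡ g i) → Σℚ f ≡ Σℚ g
  Σℚ-cong {zero}  f≗g = refl
  Σℚ-cong {suc n} f≗g = cong₂ _+_ (f≗g zero) (Σℚ-cong (λ i → f≗g (suc i)))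

  Σℚ-zero : ∀ {n} {f : Fin n → ℚ} → (∀ i → f i ≡ 0ℚ) → Σℚ f ≡ 0ℚ
  Σℚ-zero {zero}  f≗0 = refl
  Σℚ-zero {suc n} f≗0 = cong₂ _+_ (f≗0 zero) (Σℚ-zero (λ i → f≗0 (suc i)))

  Σℚ-single : ∀ {n} {f : Fin n → ℚ} (k : Fin n) → (∀ i → ¬ i ≡ k → f i ≡ 0ℚ) → Σℚ f ≡ f k
  Σℚ-single {suc n} {f} zero    off = trans (cong (f zero +_) (Σℚ-zero (λ i → off (suc i) λ ())))
                                            (+-identityʳ (f zero))
  Σℚ-single {suc n} {f} (suc k) off =
    trans (cong₂ _+_ (off zero λ ()) (Σℚ-single k (λ i i≢k → off (suc i) (i≢k ∘′ Fin.suc-injective))))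
          (+-identityˡ _)

  Σℚ-ℕtoℚ : ∀ {n} (f : Fin n → ℕ) → Σℚ (λ i → ℕtoℚ (f i)) ≡ ℕtoℚ (Σℕ f)
  Σℚ-ℕtoℚ {zero}  f = refl
  Σℚ-ℕtoℚ {suc n} f = trans (cong (ℕtoℚ (f zero) +_) (Σℚ-ℕtoℚ (λ i → f (suc i))))
                            (sym (ℕtoℚ-+ (f zero) _))

  Σℚ-nonNeg : ∀ {n} {f : Fin n → ℚ} → (∀ i → 0ℚ ≤ f i) → 0ℚ ≤ Σℚ f
  Σℚ-nonNeg {zero}      f≥0 = ≤-refl
  Σℚ-nonNeg {suc n} {f} f≥0 =
    subst (_≤ Σℚ f) (+-identityʳ 0ℚ) (+-mono-≤ (f≥0 zero) (Σℚ-nonNeg (λ i → f≥0 (suc i))))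

  x+y≡0⇒x≡0 : ∀ {x y} → 0ℚ ≤ x → 0ℚ ≤ y → x + y ≡ 0ℚ → x ≡ 0ℚ
  x+y≡0⇒x≡0 {x} {y} x≥0 y≥0 x+y≡0 =
    ≤-antisym (subst₂ _≤_ (+-identityʳ x) x+y≡0 (+-monoʳ-≤ x y≥0)) x≥0

  Σℚ≡0⇒≡0 : ∀ {n} {f : Fin n → ℚ} → (∀ i → 0ℚ ≤ f i) → Σℚ f ≡ 0ℚ → ∀ i → f i ≡ 0ℚ
  Σℚ≡0⇒≡0 {suc n} {f} f≥0 Σf≡0 zero    = x+y≡0⇒x≡0 (f≥0 zero) (Σℚ-nonNeg (λ i → f≥0 (suc i))) Σf≡0
  Σℚ≡0⇒≡0 {suc n} {f} f≥0 Σf≡0 (suc i) =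
    Σℚ≡0⇒≡0 (λ j → f≥0 (suc j))
      (x+y≡0⇒x≡0 (Σℚ-nonNeg (λ j → f≥0 (suc j))) (f≥0 zero) (trans (+-comm _ (f zero)) Σf≡0)) i

module Footrule where

  open import Data.Nat using (_+_; _≤_; s≤s; s≤s⁻¹; ∣_-_∣)
  open import Data.Nat.Properties hiding (_<?_; _≟_)
  open import Data.Bool using (Bool; true; false; if_then_else_; _xor_; not)
  open import Data.Bool.Properties using (not-involutive)
  open import Data.Fin using (zero; suc; toℕ; _<?_; _≟_)
  import Data.Fin.Properties as Fin
  open import Data.Fin.Permutation using (_⟨$⟩ˡ_; _⟨$⟩ʳ_; inverseˡ)
  open import Relation.Binary.PropositionalEquality
  open import Relation.Binary.Definitions using (tri<; tri≈; tri>)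
  open import Relation.Nullary using (¬_; yes; no)
  open import Relation.Nullary.Decidable using (⌊_⌋)
  open import Data.Empty using (⊥-elim)
  open import Function using (mk⇔)
  open DecidableTruth
  open PermutationInverse using (⟨$⟩ˡ-injective)
  open NatSum

  footrule : ∀ {n} → Permutation′ n → Permutation′ n → ℕ
  footrule σ τ = Σℕ (λ e → ∣ toℕ (σ ⟨$⟩ˡ e) - toℕ (τ ⟨$⟩ˡ e) ∣)

  footrule-self : ∀ {n} (σ : Permutation′ n) → footrule σ σ ≡ 0
  footrule-self σ = Σℕ-zero (λ e → ∣n-n∣≡0 (toℕ (σ ⟨$⟩ˡ e)))

  footrule-comm : ∀ {n} (σ τ : Permutation′ n) → footrule σ τ ≡ footrule τ σ
  footrule-comm σ τ = Σℕ-cong (λ e → ∣-∣-comm (toℕ (σ ⟨$⟩ˡ e)) (toℕ (τ ⟨$⟩ˡ e)))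

  footrule-triangle : ∀ {n} (σ τ ρ : Permutation′ n) → footrule σ ρ ≤ footrule σ τ + footrule τ ρ
  footrule-triangle {n} σ τ ρ = begin
    footrule σ ρ
      ≤⟨ Σℕ-mono-≤ (λ e → ∣-∣-triangle (pos σ e) (pos τ e) (pos ρ e)) ⟩
    Σℕ (λ e → ∣ pos σ e - pos τ e ∣ + ∣ pos τ e - pos ρ e ∣)
      ≡⟨ Σℕ-+ (λ e → ∣ pos σ e - pos τ e ∣) (λ e → ∣ pos τ e - pos ρ e ∣) ⟩
    footrule σ τ + footrule τ ρ ∎
    where
    open ≤-Reasoning
    pos : Permutation′ n → Fin n → ℕ
    pos π e = toℕ (π ⟨$⟩ˡ e)

  𝟙 : Bool → ℕ
  𝟙 b = if b then 1 else 0

  ∣𝟙-𝟙∣≡𝟙xor : ∀ a b → ∣ 𝟙 a - 𝟙 b ∣ ≡ 𝟙 (a xor b)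
  ∣𝟙-𝟙∣≡𝟙xor true  true  = refl
  ∣𝟙-𝟙∣≡𝟙xor true  false = refl
  ∣𝟙-𝟙∣≡𝟙xor false true  = refl
  ∣𝟙-𝟙∣≡𝟙xor false false = refl

  not-xor-not : ∀ a b → (not a xor not b) ≡ (a xor b)
  not-xor-not true  b = refl
  not-xor-not false b = not-involutive b

  Σℕ-𝟙< : ∀ {n} (m : Fin n) → Σℕ (λ (i : Fin n) → 𝟙 ⌊ i <? m ⌋) ≡ toℕ m
  Σℕ-𝟙< {suc n} zero    = Σℕ-zero (λ (i : Fin (suc n)) → cong 𝟙 (⌊⌋-false (i <? zero {n}) λ ()))
  Σℕ-𝟙< {suc n} (suc m) = cong suc (trans (Σℕ-cong (λ (i : Fin n) → cong 𝟙 (⌊⌋-⇔ (mk⇔ s≤s⁻¹ s≤s) (suc i <? suc m) (i <? m)))) (Σℕ-𝟙< m))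

  Σℕ²-symmetric≡upper+upper : ∀ {n} (g : Fin n → Fin n → ℕ) → (∀ e f → g e f ≡ g f e) → (∀ e → g e e ≡ 0) →
                  Σℕ (λ e → Σℕ (λ f → g e f))
                  ≡ Σℕ (λ e → Σℕ (λ f → if ⌊ e <? f ⌋ then g e f else 0))
                    + Σℕ (λ e → Σℕ (λ f → if ⌊ e <? f ⌋ then g e f else 0))
  Σℕ²-symmetric≡upper+upper {n} g g-sym g-diag = begin
    Σℕ (λ e → Σℕ (λ f → g e f))
      ≡⟨ Σℕ-cong (λ e → Σℕ-cong (λ f → split e f)) ⟩
    Σℕ (λ e → Σℕ (λ f → U e f + U f e))
      ≡⟨ Σℕ-cong (λ e → Σℕ-+ (U e) (λ f → U f e)) ⟩
    Σℕ (λ e → Σℕ (λ f → U e f) + Σℕ (λ f → U f e))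
      ≡⟨ Σℕ-+ (λ e → Σℕ (U e)) (λ e → Σℕ (λ f → U f e)) ⟩
    Σℕ (λ e → Σℕ (U e)) + Σℕ (λ e → Σℕ (λ f → U f e))
      ≡⟨ cong (Σℕ (λ e → Σℕ (U e)) +_) (Σℕ-comm (λ e f → U f e)) ⟩
    Σℕ (λ e → Σℕ (U e)) + Σℕ (λ e → Σℕ (U e)) ∎
    where
    open ≡-Reasoning
    U : Fin n → Fin n → ℕ
    U e f = if ⌊ e <? f ⌋ then g e f else 0
    split : ∀ e f → g e f ≡ (if ⌊ e <? f ⌋ then g e f else 0) + (if ⌊ f <? e ⌋ then g f e else 0)
    split e f with e <? f | f <? e
    ... | yes e<f | yes f<e = ⊥-elim (Fin.<-asym e<f f<e)
    ... | yes _   | no  _   = sym (+-identityʳ (g e f))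
    ... | no  _   | yes _   = g-sym e f
    ... | no  e≮f | no  f≮e with Fin.<-cmp e f
    ...   | tri< e<f _ _ = ⊥-elim (e≮f e<f)
    ...   | tri≈ _ refl _ = g-diag e
    ...   | tri> _ _ f<e = ⊥-elim (f≮e f<e)

  module _ {n : ℕ} where

    before : Permutation′ n → Fin n → Fin n → Bool
    before π e f = ⌊ π ⟨$⟩ˡ e <? π ⟨$⟩ˡ f ⌋

    position≡#before : ∀ (π : Permutation′ n) e → toℕ (π ⟨$⟩ˡ e) ≡ Σℕ (λ f → 𝟙 (before π f e))
    position≡#before π e = sym (begin
      Σℕ (λ f → 𝟙 (before π f e))              ≡⟨ Σℕ-permute (λ f → 𝟙 (before π f e)) π ⟩
      Σℕ (λ i → 𝟙 (before π (π ⟨$⟩ʳ i) e))   ≡⟨ Σℕ-cong (λ i → cong (λ j → 𝟙 ⌊ j <? π ⟨$⟩ˡ e ⌋) (inverseˡ π {i})) ⟩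
      Σℕ (λ (i : Fin n) → 𝟙 ⌊ i <? π ⟨$⟩ˡ e ⌋) ≡⟨ Σℕ-𝟙< (π ⟨$⟩ˡ e) ⟩
      toℕ (π ⟨$⟩ˡ e)                          ∎)
      where open ≡-Reasoning

    before-flip : ∀ (π : Permutation′ n) {e f} → ¬ e ≡ f → before π f e ≡ not (before π e f)
    before-flip π {e} {f} e≢f with π ⟨$⟩ˡ e <? π ⟨$⟩ˡ f | π ⟨$⟩ˡ f <? π ⟨$⟩ˡ e
    ... | yes p | yes q = ⊥-elim (Fin.<-asym p q)
    ... | yes _ | no  _ = refl
    ... | no  _ | yes _ = refl
    ... | no  p | no  q with Fin.<-cmp (π ⟨$⟩ˡ e) (π ⟨$⟩ˡ f)
    ...   | tri< x _ _ = ⊥-elim (p x)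
    ...   | tri≈ _ x _ = ⊥-elim (e≢f (⟨$⟩ˡ-injective π x))
    ...   | tri> _ _ x = ⊥-elim (q x)

    discord : Permutation′ n → Permutation′ n → Fin n → Fin n → Bool
    discord π σ e f = before π e f xor before σ e f

    discord-sym : ∀ (π σ : Permutation′ n) e f → discord π σ f e ≡ discord π σ e f
    discord-sym π σ e f with e ≟ f
    ... | yes refl = refl
    ... | no  e≢f  = trans (cong₂ _xor_ (before-flip π e≢f) (before-flip σ e≢f))
                           (not-xor-not (before π e f) (before σ e f))

    before-irrefl : ∀ (π : Permutation′ n) e → before π e e ≡ false
    before-irrefl π e = ⌊⌋-false (π ⟨$⟩ˡ e <? π ⟨$⟩ˡ e) (Fin.<-irrefl refl)

    discord-irrefl : ∀ (π σ : Permutation′ n) e → discord π σ e e ≡ false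
    discord-irrefl π σ e = cong₂ _xor_ (before-irrefl π e) (before-irrefl σ e)

    -- Half of the Diaconis–Graham inequality: each element's displacement is at
    -- most the number of discordant pairs it belongs to.
    footrule≤2dKT : ∀ (π σ : Permutation′ n) → footrule π σ ≤ dKT π σ + dKT π σ
    footrule≤2dKT π σ = begin
      footrule π σ
        ≡⟨ Σℕ-cong (λ e → cong₂ ∣_-_∣ (position≡#before π e) (position≡#before σ e)) ⟩
      Σℕ (λ e → ∣ Σℕ (λ f → 𝟙 (before π f e)) - Σℕ (λ f → 𝟙 (before σ f e)) ∣)
        ≤⟨ Σℕ-mono-≤ (λ e → ∣Σℕ-Σℕ∣≤Σℕ∣-∣ (λ f → 𝟙 (before π f e)) (λ f → 𝟙 (before σ f e))) ⟩
      Σℕ (λ e → Σℕ (λ f → ∣ 𝟙 (before π f e) - 𝟙 (before σ f e) ∣))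
        ≡⟨ Σℕ-cong (λ e → Σℕ-cong (λ f → trans (∣𝟙-𝟙∣≡𝟙xor (before π f e) (before σ f e))
                                              (cong 𝟙 (discord-sym π σ e f)))) ⟩
      Σℕ (λ e → Σℕ (λ f → 𝟙 (discord π σ e f)))
        ≡⟨ Σℕ²-symmetric≡upper+upper (λ e f → 𝟙 (discord π σ e f))
             (λ e f → cong 𝟙 (sym (discord-sym π σ e f))) (λ e → cong 𝟙 (discord-irrefl π σ e)) ⟩
      dKT π σ + dKT π σ ∎
      where open ≤-Reasoning

module PermutationMatrix where

  open import Data.Bool using (true; false)
  open import Data.Rational as ℚ using (ℚ; 0ℚ; 1ℚ; _*_; _≤_)
  open import Data.Rational.Properties
    using (*-zeroˡ; *-zeroʳ; *-identityˡ; *-identityʳ; ≤-refl; ≤-reflexive; nonNegative⁻¹; nonNeg*nonNeg⇒nonNeg)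
  open import Data.Nat using (∣_-_∣)
  open import Data.Fin using (toℕ; _≟_)
  open import Data.Fin.Permutation using (_⟨$⟩ʳ_; _⟨$⟩ˡ_; inverseˡ)
  open import Data.Product using (_,_; proj₁; proj₂)
  open import Relation.Binary.PropositionalEquality
  open import Relation.Nullary using (¬_; yes; no)
  open import Relation.Nullary.Decidable using (⌊_⌋)
  open import Data.Empty using (⊥-elim)
  open import Function using (_∘_)
  open PermutationInverse
  open RationalSum
  open Footrule using (footrule)

  module _ {n : ℕ} (π : Permutation′ n) where

    permMatrix-on : ∀ {e i} → i ≡ π ⟨$⟩ˡ e → permMatrix π e i ≡ 1ℚ
    permMatrix-on {e} {i} i≡πˡe with π ⟨$⟩ʳ i ≟ e
    ... | yes _    = refl
    ... | no  πi≢e = ⊥-elim (πi≢e (≡⟨$⟩ˡ⇒⟨$⟩ʳ≡ π i≡πˡe))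

    permMatrix-off : ∀ {e i} → ¬ i ≡ π ⟨$⟩ˡ e → permMatrix π e i ≡ 0ℚ
    permMatrix-off {e} {i} i≢πˡe with π ⟨$⟩ʳ i ≟ e
    ... | yes πi≡e = ⊥-elim (i≢πˡe (⟨$⟩ʳ≡⇒≡⟨$⟩ˡ π πi≡e))
    ... | no  _    = refl

    permMatrix-nonNeg : Nonneg (permMatrix π)
    permMatrix-nonNeg e i with ⌊ π ⟨$⟩ʳ i ≟ e ⌋
    ... | true  = nonNegative⁻¹ 1ℚ
    ... | false = ≤-refl

    permMatrix-doublyStochastic : DoublyStochastic (permMatrix π)
    permMatrix-doublyStochastic = (permMatrix-nonNeg , row) , column
      where
      row : ∀ e → Σℚ (λ i → permMatrix π e i) ≡ 1ℚ
      row e = trans (Σℚ-single (π ⟨$⟩ˡ e) (λ i → permMatrix-off)) (permMatrix-on refl)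
      column : ∀ i → Σℚ (λ e → permMatrix π e i) ≡ 1ℚ
      column i = trans (Σℚ-single (π ⟨$⟩ʳ i) (λ e e≢πi → permMatrix-off (e≢πi ∘ sym ∘ ≡⟨$⟩ˡ⇒⟨$⟩ʳ≡ π)))
                       (permMatrix-on (sym (inverseˡ π)))

  flowCost-cong : ∀ {n} {f g : Flow n} → (∀ e i j → f e i j ≡ g e i j) → flowCost f ≡ flowCost g
  flowCost-cong f≗g = Σℚ-cong (λ e → Σℚ-cong (λ i → Σℚ-cong (λ j →
    cong (ℕtoℚ ∣ toℕ i - toℕ j ∣ *_) (f≗g e i j))))

  module _ {n : ℕ} (σ τ : Permutation′ n) where

    productFlow : Flow n
    productFlow e i j = permMatrix σ e i * permMatrix τ e j

    productFlow-offRow : ∀ {e i} j → ¬ i ≡ σ ⟨$⟩ˡ e → productFlow e i j ≡ 0ℚ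
    productFlow-offRow {e} {i} j i≢σˡe = trans (cong (_* permMatrix τ e j) (permMatrix-off σ i≢σˡe))
                                               (*-zeroˡ (permMatrix τ e j))

    productFlow-offColumn : ∀ {e} i {j} → ¬ j ≡ τ ⟨$⟩ˡ e → productFlow e i j ≡ 0ℚ
    productFlow-offColumn {e} i {j} j≢τˡe = trans (cong (permMatrix σ e i *_) (permMatrix-off τ j≢τˡe))
                                                  (*-zeroʳ (permMatrix σ e i))

    productFlow-on : ∀ e → productFlow e (σ ⟨$⟩ˡ e) (τ ⟨$⟩ˡ e) ≡ 1ℚ
    productFlow-on e = cong₂ _*_ (permMatrix-on σ refl) (permMatrix-on τ refl)

    productFlow-feasible : FeasibleFlow (permMatrix σ) (permMatrix τ) productFlow
    productFlow-feasible = nonNeg , columns , rows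
      where
      nonNeg : ∀ e i j → 0ℚ ≤ productFlow e i j
      nonNeg e i j = nonNegative⁻¹ (productFlow e i j)
        {{nonNeg*nonNeg⇒nonNeg (permMatrix σ e i) {{ℚ.nonNegative (permMatrix-nonNeg σ e i)}}
                               (permMatrix τ e j) {{ℚ.nonNegative (permMatrix-nonNeg τ e j)}}}}
      columns : ∀ e j → Σℚ (λ i → productFlow e i j) ≡ permMatrix τ e j
      columns e j = trans (Σℚ-single (σ ⟨$⟩ˡ e) (λ i → productFlow-offRow j))
                          (trans (cong (_* permMatrix τ e j) (permMatrix-on σ refl)) (*-identityˡ _))
      rows : ∀ e i → Σℚ (λ j → productFlow e i j) ≡ permMatrix σ e i
      rows e i = trans (Σℚ-single (τ ⟨$⟩ˡ e) (λ j → productFlow-offColumn i))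
                       (trans (cong (permMatrix σ e i *_) (permMatrix-on τ refl)) (*-identityʳ _))

    module _ {g : Flow n} (g-feasible : FeasibleFlow (permMatrix σ) (permMatrix τ) g) where

      private
        g≥0 : ∀ e i j → 0ℚ ≤ g e i j
        g≥0 = proj₁ g-feasible
        g-columns : ∀ e j → Σℚ (λ i → g e i j) ≡ permMatrix τ e j
        g-columns = proj₁ (proj₂ g-feasible)
        g-rows : ∀ e i → Σℚ (λ j → g e i j) ≡ permMatrix σ e i
        g-rows = proj₂ (proj₂ g-feasible)

      feasible-offRow : ∀ {e i} j → ¬ i ≡ σ ⟨$⟩ˡ e → g e i j ≡ 0ℚ
      feasible-offRow {e} {i} j i≢σˡe =
        Σℚ≡0⇒≡0 (g≥0 e i) (trans (g-rows e i) (permMatrix-off σ i≢σˡe)) j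

      feasible-offColumn : ∀ {e} i {j} → ¬ j ≡ τ ⟨$⟩ˡ e → g e i j ≡ 0ℚ
      feasible-offColumn {e} i {j} j≢τˡe =
        Σℚ≡0⇒≡0 (λ i′ → g≥0 e i′ j) (trans (g-columns e j) (permMatrix-off τ j≢τˡe)) i

      feasible-on : ∀ e → g e (σ ⟨$⟩ˡ e) (τ ⟨$⟩ˡ e) ≡ 1ℚ
      feasible-on e = begin
        g e (σ ⟨$⟩ˡ e) (τ ⟨$⟩ˡ e)     ≡⟨ Σℚ-single (τ ⟨$⟩ˡ e) (λ j → feasible-offColumn (σ ⟨$⟩ˡ e)) ⟨
        Σℚ (λ j → g e (σ ⟨$⟩ˡ e) j)   ≡⟨ g-rows e (σ ⟨$⟩ˡ e) ⟩
        permMatrix σ e (σ ⟨$⟩ˡ e)     ≡⟨ permMatrix-on σ refl ⟩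
        1ℚ                            ∎
        where open ≡-Reasoning

      -- The marginals are unit vectors, so the transportation polytope is a single point.
      feasible⇒≡productFlow : ∀ e i j → g e i j ≡ productFlow e i j
      feasible⇒≡productFlow e i j with i ≟ σ ⟨$⟩ˡ e | j ≟ τ ⟨$⟩ˡ e
      ... | no i≢σˡe | _        = trans (feasible-offRow j i≢σˡe) (sym (productFlow-offRow j i≢σˡe))
      ... | yes _    | no j≢τˡe = trans (feasible-offColumn i j≢τˡe) (sym (productFlow-offColumn i j≢τˡe))
      ... | yes refl | yes refl = trans (feasible-on e) (sym (productFlow-on e))

    flowCost-productFlow : flowCost productFlow ≡ ℕtoℚ (footrule σ τ)
    flowCost-productFlow =
      trans (Σℚ-cong rowCost) (Σℚ-ℕtoℚ (λ e → ∣ toℕ (σ ⟨$⟩ˡ e) - toℕ (τ ⟨$⟩ˡ e) ∣))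
      where
      c : Fin n → Fin n → ℚ
      c i j = ℕtoℚ ∣ toℕ i - toℕ j ∣
      c*0≡0 : ∀ i j {x} → x ≡ 0ℚ → c i j * x ≡ 0ℚ
      c*0≡0 i j refl = *-zeroʳ (c i j)
      rowCost : ∀ e → Σℚ (λ i → Σℚ (λ j → c i j * productFlow e i j)) ≡ c (σ ⟨$⟩ˡ e) (τ ⟨$⟩ˡ e)
      rowCost e = begin
        Σℚ (λ i → Σℚ (λ j → c i j * productFlow e i j))
          ≡⟨ Σℚ-single (σ ⟨$⟩ˡ e) (λ i i≢σˡe → Σℚ-zero (λ j → c*0≡0 i j (productFlow-offRow j i≢σˡe))) ⟩
        Σℚ (λ j → c (σ ⟨$⟩ˡ e) j * productFlow e (σ ⟨$⟩ˡ e) j)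
          ≡⟨ Σℚ-single (τ ⟨$⟩ˡ e) (λ j j≢τˡe → c*0≡0 (σ ⟨$⟩ˡ e) j (productFlow-offColumn (σ ⟨$⟩ˡ e) j≢τˡe)) ⟩
        c (σ ⟨$⟩ˡ e) (τ ⟨$⟩ˡ e) * productFlow e (σ ⟨$⟩ˡ e) (τ ⟨$⟩ˡ e)
          ≡⟨ cong (c (σ ⟨$⟩ˡ e) (τ ⟨$⟩ˡ e) *_) (productFlow-on e) ⟩
        c (σ ⟨$⟩ˡ e) (τ ⟨$⟩ˡ e) * 1ℚ
          ≡⟨ *-identityʳ _ ⟩
        c (σ ⟨$⟩ˡ e) (τ ⟨$⟩ˡ e) ∎
        where open ≡-Reasoning

    permMatrix-isFootrule : IsFootrule (permMatrix σ) (permMatrix τ) (ℕtoℚ (footrule σ τ))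
    permMatrix-isFootrule =
      (productFlow , productFlow-feasible , flowCost-productFlow) ,
      λ g g-feasible → ≤-reflexive (trans (sym flowCost-productFlow)
                                          (sym (flowCost-cong (feasible⇒≡productFlow g-feasible))))

module MoveToFront where

  open import Data.Nat using (_+_; _≤_; ∣_-_∣)
  open import Data.Nat.Properties hiding (_≟_)
  open import Data.Bool using (Bool; true; false; if_then_else_)
  import Data.Bool.Properties as Bool
  open import Data.Fin using (zero; suc; toℕ; _≟_)
  import Data.Fin.Properties as Fin
  open import Data.Fin.Permutation using (_⟨$⟩ʳ_; _⟨$⟩ˡ_; inverseˡ; inverseʳ; _∘ₚ_; transpose)
  import Data.Fin.Permutation.Components as PC
  open import Data.Vec using (lookup)
  open import Data.Rational using (0ℚ; 1ℚ)
  open import Data.Product using (Σ; ∃; _×_; _,_)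
  open import Relation.Binary.PropositionalEquality
  open import Relation.Nullary using (¬_; yes; no)
  open import Relation.Nullary.Decidable using (⌊_⌋)
  open import Data.Empty using (⊥-elim)
  open import Function using (_∘_)
  open DecidableTruth
  open NatSum
  open RationalSum using (Σℚ-zero; Σℚ-single)
  open Footrule using (footrule)
  open PermutationInverse using (≡⟨$⟩ˡ⇒⟨$⟩ʳ≡)
  open PermutationMatrix using (permMatrix-on; permMatrix-off)

  ServesRequest : ∀ {n} → Subset n → Matrix n → Set
  ServesRequest R A = Σℚ (λ e → if lookup R e then col1 (A e) else 0ℚ) ≡ 1ℚ

  served⇒nonempty : ∀ {n} (R : Subset n) (A : Matrix n) → ServesRequest R A → ∃ λ e → lookup R e ≡ true
  served⇒nonempty R A served with Fin.any? (λ e → lookup R e Bool.≟ true)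
  ... | yes found = found
  ... | no  none  = ⊥-elim (0≢1 (trans (sym (Σℚ-zero unserved)) served))
    where
    0≢1 : ¬ 0ℚ ≡ 1ℚ
    0≢1 ()
    unserved : ∀ e → (if lookup R e then col1 (A e) else 0ℚ) ≡ 0ℚ
    unserved e with lookup R e in e∈R
    ... | true  = ⊥-elim (none (e , e∈R))
    ... | false = refl

  firstHit-attained : ∀ {n} (p : Fin n → Bool) (i : Fin n) → p i ≡ true →
                      ∃ λ k → p k ≡ true × firstHit p ≡ suc (toℕ k)
  firstHit-attained {suc n} p i pi with p zero in p0
  ... | true = zero , p0 , refl
  firstHit-attained {suc n} p zero    pi | false with () ← trans (sym p0) pi
  firstHit-attained {suc n} p (suc i) pi | false with firstHit-attained (λ j → p (suc j)) i pi
  ... | k , pk , hit = suc k , pk , cong suc hit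

  permMatrix-serves : ∀ {n} (R : Subset (suc n)) (σ : Permutation′ (suc n)) →
                      lookup R (σ ⟨$⟩ʳ zero) ≡ true → ServesRequest R (permMatrix σ)
  permMatrix-serves R σ front∈R = begin
    Σℚ (λ e → if lookup R e then permMatrix σ e zero else 0ℚ)
      ≡⟨ Σℚ-single (σ ⟨$⟩ʳ zero) (λ e e≢front → trans (Bool.if-cong-then (lookup R e)
           (permMatrix-off σ (e≢front ∘ sym ∘ ≡⟨$⟩ˡ⇒⟨$⟩ʳ≡ σ))) (Bool.if-eta (lookup R e))) ⟩
    (if lookup R (σ ⟨$⟩ʳ zero) then permMatrix σ (σ ⟨$⟩ʳ zero) zero else 0ℚ)
      ≡⟨ Bool.if-cong front∈R ⟩
    permMatrix σ (σ ⟨$⟩ʳ zero) zero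
      ≡⟨ permMatrix-on σ (sym (inverseˡ σ)) ⟩
    1ℚ ∎
    where open ≡-Reasoning

  transpose-self : ∀ {n} (i j : Fin n) → PC.transpose i j i ≡ j
  transpose-self i j with i ≟ i
  ... | yes _   = refl
  ... | no  i≢i = ⊥-elim (i≢i refl)

  Σℕ-indicator : ∀ {n} (a : Fin n) x → Σℕ (λ i → if ⌊ i ≟ a ⌋ then x else 0) ≡ x
  Σℕ-indicator a x = trans (Σℕ-single a (λ i i≢a → Bool.if-cong (⌊⌋-false (i ≟ a) i≢a)))
                           (Bool.if-cong (⌊⌋-true (a ≟ a) refl))

  transpose-displacement : ∀ {n} (k i : Fin (suc n)) →
    ∣ toℕ (PC.transpose k zero i) - toℕ i ∣
      ≤ (if ⌊ i ≟ k ⌋ then toℕ k else 0) + (if ⌊ i ≟ zero ⌋ then toℕ k else 0)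
  transpose-displacement k i with i ≟ k
  ... | yes refl = m≤m+n (toℕ i) _
  ... | no  _ with i ≟ zero
  ...   | yes refl = ≤-reflexive (∣-∣-identityʳ (toℕ k))
  ...   | no  _    = ≤-reflexive (∣n-n∣≡0 (toℕ i))

  footrule-transpose : ∀ {n} (k : Fin (suc n)) (π : Permutation′ (suc n)) →
                       footrule (transpose zero k ∘ₚ π) π ≤ toℕ k + toℕ k
  footrule-transpose {n} k π = begin
    Σℕ (λ e → shift (π ⟨$⟩ˡ e))              ≡⟨ Σℕ-permute (λ e → shift (π ⟨$⟩ˡ e)) π ⟩
    Σℕ (λ i → shift (π ⟨$⟩ˡ (π ⟨$⟩ʳ i)))    ≡⟨ Σℕ-cong (λ i → cong shift (inverseˡ π {i})) ⟩
    Σℕ shift                                 ≤⟨ Σℕ-mono-≤ (transpose-displacement k) ⟩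
    Σℕ (λ i → at k i + at zero i)            ≡⟨ Σℕ-+ (at k) (at zero) ⟩
    Σℕ (at k) + Σℕ (at zero)                 ≡⟨ cong₂ _+_ (Σℕ-indicator k (toℕ k)) (Σℕ-indicator (zero {n}) (toℕ k)) ⟩
    toℕ k + toℕ k                            ∎
    where
    open ≤-Reasoning
    shift : Fin (suc n) → ℕ
    shift i = ∣ toℕ (PC.transpose k zero i) - toℕ i ∣
    at : Fin (suc n) → Fin (suc n) → ℕ
    at a i = if ⌊ i ≟ a ⌋ then toℕ k else 0

  -- The first element of π that lies in R is moved to the front.
  moveToFront : ∀ {n} (R : Subset n) (π : Permutation′ n) → ∃ (λ e → lookup R e ≡ true) →
                Σ (Permutation′ n) λ σ →
                  ServesRequest R (permMatrix σ) × footrule σ π ≤ coverTime π R + coverTime π R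
  moveToFront {suc n} R π (e , e∈R)
    with firstHit-attained (λ i → lookup R (π ⟨$⟩ʳ i)) (π ⟨$⟩ˡ e)
                           (trans (cong (lookup R) (inverseʳ π)) e∈R)
  ... | k , πk∈R , cover≡1+k =
    transpose zero k ∘ₚ π ,
    permMatrix-serves R (transpose zero k ∘ₚ π)
      (trans (cong (λ i → lookup R (π ⟨$⟩ʳ i)) (transpose-self zero k)) πk∈R) ,
    ≤-trans (footrule-transpose k π)
            (subst (λ c → toℕ k + toℕ k ≤ c + c) (sym cover≡1+k) (+-mono-≤ (n≤1+n _) (n≤1+n _)))

module Trajectory where

  open import Data.Nat using (_+_; _*_; _≤_; z≤n)
  open import Data.Nat.Properties
  open import Data.Nat.Tactic.RingSolver using (solve-∀)
  open import Data.Fin using (zero; suc)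
  open import Relation.Binary.PropositionalEquality
  open NatSum
  open Footrule using (footrule; footrule-self; footrule-comm; footrule-triangle; footrule≤2dKT)

  prevOf-map : ∀ {X Y : Set} {T} (f : X → Y) (x0 : X) (xs : Fin T → X) t →
               prevOf (f x0) (λ s → f (xs s)) t ≡ f (prevOf x0 xs t)
  prevOf-map {T = suc T} f x0 xs zero    = refl
  prevOf-map {T = suc T} f x0 xs (suc t) = refl

  Σℕ-prevOf≤ : ∀ {X : Set} {T} (d : X → X → ℕ) → (∀ x → d x x ≡ 0) → (x0 : X) (xs ys : Fin T → X) →
               Σℕ (λ t → d (prevOf x0 xs t) (prevOf x0 ys t)) ≤ Σℕ (λ t → d (xs t) (ys t))
  Σℕ-prevOf≤ {T = zero}  d d-refl x0 xs ys = z≤n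
  Σℕ-prevOf≤ {T = suc T} d d-refl x0 xs ys rewrite d-refl x0 = Σℕ-init≤ (λ t → d (xs t) (ys t))

  [2c+[2k+2c]]+2k≡4[c+k] : ∀ c k → (c + c) + ((k + k) + (c + c)) + (k + k) ≡ 4 * (c + k)
  [2c+[2k+2c]]+2k≡4[c+k] = solve-∀

  -- F(σᵗ, σᵗ⁻¹) ≤ F(σᵗ, πᵗ) + F(πᵗ, πᵗ⁻¹) + F(πᵗ⁻¹, σᵗ⁻¹): the outer terms sum to
  -- at most 4·Σ c, the middle ones to at most 2·Σ dKT.
  footrule-path≤ : ∀ {n T} (π0 : Permutation′ n) (πs σs : Fin T → Permutation′ n) (c : Fin T → ℕ) →
                   (∀ t → footrule (σs t) (πs t) ≤ c t + c t) →
                   Σℕ (λ t → footrule (σs t) (prevOf π0 σs t))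
                     ≤ 4 * (Σℕ c + Σℕ (λ t → dKT (πs t) (prevOf π0 πs t)))
  footrule-path≤ {n} {T} π0 πs σs c σ≈π = begin
    Σℕ (λ t → footrule (σs t) (σ′ t))
      ≤⟨ Σℕ-mono-≤ (λ t → ≤-trans (footrule-triangle (σs t) (πs t) (σ′ t))
                                  (+-monoʳ-≤ (a t) (footrule-triangle (πs t) (π′ t) (σ′ t)))) ⟩
    Σℕ (λ t → a t + (b t + g t))
      ≡⟨ trans (Σℕ-+ a (λ t → b t + g t)) (cong (Σℕ a +_) (Σℕ-+ b g)) ⟩
    Σℕ a + (Σℕ b + Σℕ g)
      ≤⟨ +-mono-≤ Σa≤ (+-mono-≤ Σb≤ Σg≤) ⟩
    (C + C) + ((K + K) + (C + C))
      ≤⟨ m≤m+n _ (K + K) ⟩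
    (C + C) + ((K + K) + (C + C)) + (K + K)
      ≡⟨ [2c+[2k+2c]]+2k≡4[c+k] C K ⟩
    4 * (C + K) ∎
    where
    open ≤-Reasoning
    π′ σ′ : Fin T → Permutation′ n
    π′ = prevOf π0 πs
    σ′ = prevOf π0 σs
    C K : ℕ
    C = Σℕ c
    K = Σℕ (λ t → dKT (πs t) (π′ t))
    a b g : Fin T → ℕ
    a t = footrule (σs t) (πs t)
    b t = footrule (πs t) (π′ t)
    g t = footrule (π′ t) (σ′ t)
    Σa≤ : Σℕ a ≤ C + C
    Σa≤ = ≤-trans (Σℕ-mono-≤ σ≈π) (≤-reflexive (Σℕ-+ c c))
    Σb≤ : Σℕ b ≤ K + K
    Σb≤ = ≤-trans (Σℕ-mono-≤ (λ t → footrule≤2dKT (πs t) (π′ t)))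
                  (≤-reflexive (Σℕ-+ (λ t → dKT (πs t) (π′ t)) (λ t → dKT (πs t) (π′ t))))
    Σg≤ : Σℕ g ≤ C + C
    Σg≤ = begin
      Σℕ g                              ≤⟨ Σℕ-prevOf≤ footrule footrule-self π0 πs σs ⟩
      Σℕ (λ t → footrule (πs t) (σs t)) ≡⟨ Σℕ-cong (λ t → footrule-comm (πs t) (σs t)) ⟩
      Σℕ a                              ≤⟨ Σa≤ ⟩
      C + C                             ∎

open import Data.Rational using (ℚ; _≤_; _*_)
open import Data.Rational.Properties using (module ≤-Reasoning)
open import Data.Product using (Σ; _×_; _,_; proj₁; proj₂)
open import Relation.Binary.PropositionalEquality using (subst; sym)
open RationalSum using (Σℚ-ℕtoℚ; ℕtoℚ-mono-≤; ℕtoℚ-*)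
open Footrule using (footrule)
open PermutationMatrix using (permMatrix-doublyStochastic; permMatrix-isFootrule)
open MoveToFront using (ServesRequest; served⇒nonempty; moveToFront)
open Trajectory using (prevOf-map; footrule-path≤)

lemma9 : (n T : ℕ) (R : Fin T → Subset n) (π0 : Permutation′ n)
         (As : Fin T → Matrix n) → OptimalMTF R π0 As →
         (ds : Fin T → ℚ) → FootruleValues π0 As ds →
         (πs : Fin T → Permutation′ n) →
         Σℚ ds ≤ ℕtoℚ 4 * ℕtoℚ (msscCost R π0 πs)
lemma9 n T R π0 As (As-feasible , As-optimal) ds ds-footrule πs = begin
  Σℚ ds                                ≤⟨ As-optimal Bs Bs-feasible ds dBs ds-footrule dBs-footrule ⟩
  Σℚ dBs                               ≡⟨ Σℚ-ℕtoℚ (λ t → footrule (σs t) (prevOf π0 σs t)) ⟩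
  ℕtoℚ (Σℕ (λ t → footrule (σs t) (prevOf π0 σs t)))
                                       ≤⟨ ℕtoℚ-mono-≤ (footrule-path≤ π0 πs σs cover (λ t → proj₂ (proj₂ (front t)))) ⟩
  ℕtoℚ (4 ℕ.* msscCost R π0 πs)        ≡⟨ ℕtoℚ-* 4 (msscCost R π0 πs) ⟩
  ℕtoℚ 4 * ℕtoℚ (msscCost R π0 πs)     ∎
  where
  open ≤-Reasoning
  cover : Fin T → ℕ
  cover t = coverTime (πs t) (R t)
  front : ∀ t → Σ (Permutation′ n) λ σ →
                  ServesRequest (R t) (permMatrix σ) × footrule σ (πs t) ℕ.≤ cover t ℕ.+ cover t
  front t = moveToFront (R t) (πs t) (served⇒nonempty (R t) (As t) (proj₂ As-feasible t))
  σs : Fin T → Permutation′ n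
  σs t = proj₁ (front t)
  Bs : Fin T → Matrix n
  Bs t = permMatrix (σs t)
  Bs-feasible : FeasibleMTF R Bs
  Bs-feasible = (λ t → permMatrix-doublyStochastic (σs t)) , (λ t → proj₁ (proj₂ (front t)))
  dBs : Fin T → ℚ
  dBs t = ℕtoℚ (footrule (σs t) (prevOf π0 σs t))
  dBs-footrule : FootruleValues π0 Bs dBs
  dBs-footrule t = subst (λ M → IsFootrule (Bs t) M (dBs t)) (sym (prevOf-map permMatrix π0 σs t))
                         (permMatrix-isFootrule (σs t) (prevOf π0 σs t))
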